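{- In 8-move peg solitaire on the standard 33-hole board, the $C9$-complement problem is unsolvable: starting from the position in which every hole is occupied except the nine central holes $c3,d3,e3,c4,d4,e4,c5,d5,e5$, it is impossible to reach, by legal jumps, the position in which exactly these nine central holes are occupied.
   Context: The standard 33-hole board has columns a–g ($x=1,\dots,7$) and rows 1–7 ($y=1,\dots,7$) and consists of the holes $(x,y)$ with $3\le x\le 5$ or $3\le y\le 5$. Each hole is empty or holds one peg. In 8-move solitaire a jump takes a peg at hole $p$, with hole $p+v$ occupied and $p+2v$ empty, where $v$ is one of the 8 horizontal, vertical or diagonal unit steps and all three holes lie on the board; the peg moves to $p+2v$ and the peg at $p+v$ is removed. -}

module Defs where

open import Data.Bool using (Bool; true; false)
open import Data.Integer using (ℤ; +_; _+_; _*_; -[1+_])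
open import Data.Product using (_×_; Σ; _,_)
open import Data.Sum using (_⊎_)
open import Relation.Binary.PropositionalEquality using (_≡_)
open import Relation.Nullary using (¬_)
import Data.Integer as ℤ

-- Holes are integer coordinates (x , y); column a..g is x = 1..7, row 1..7 is y = 1..7.
Hole : Set
Hole = ℤ × ℤ

In3-5 : ℤ → Set
In3-5 z = (+ 3 ℤ.≤ z) × (z ℤ.≤ + 5)

In1-7 : ℤ → Set
In1-7 z = (+ 1 ℤ.≤ z) × (z ℤ.≤ + 7)

OnBoard : Hole → Set
OnBoard (x , y) = In1-7 x × In1-7 y × (In3-5 x ⊎ In3-5 y)

-- A position assigns to each hole whether it holds a peg (values off the
-- board are irrelevant; all comparisons below are restricted to board holes).
Position : Set
Position = Hole → Bool

data Dir : Set where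
  E W N S NE NW SE SW : Dir

vec : Dir → Hole
vec E  = (+ 1 , + 0)
vec W  = (-[1+ 0 ] , + 0)
vec N  = (+ 0 , + 1)
vec S  = (+ 0 , -[1+ 0 ])
vec NE = (+ 1 , + 1)
vec NW = (-[1+ 0 ] , + 1)
vec SE = (+ 1 , -[1+ 0 ])
vec SW = (-[1+ 0 ] , -[1+ 0 ])

step : Hole → ℤ → Dir → Hole
step (a , b) k v with vec v
... | (c , d) = (a + k * c , b + k * d)

data Jump (P Q : Position) : Set where
  jump : (p : Hole) (v : Dir) →
    OnBoard p → OnBoard (step p (+ 1) v) → OnBoard (step p (+ 2) v) →
    P p ≡ true → P (step p (+ 1) v) ≡ true → P (step p (+ 2) v) ≡ false →
    Q p ≡ false → Q (step p (+ 1) v) ≡ false → Q (step p (+ 2) v) ≡ true →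
    (∀ h → ¬ h ≡ p → ¬ h ≡ step p (+ 1) v → ¬ h ≡ step p (+ 2) v → Q h ≡ P h) →
    Jump P Q

data Reachable (P : Position) : Position → Set where
  done : Reachable P P
  _▷_  : ∀ {Q R} → Reachable P Q → Jump Q R → Reachable P R

SameOnBoard : Position → Position → Set
SameOnBoard P Q = ∀ h → OnBoard h → P h ≡ Q h

in3-5? : ℤ → Bool
in3-5? z with + 3 ℤ.≤ᵇ z | z ℤ.≤ᵇ + 5
... | true | true = true
... | _ | _ = false

central : Hole → Bool
central (x , y) with in3-5? x | in3-5? y
... | true | true = true
... | _ | _ = false

startC9c : Position
startC9c h with central h
... | true = false
... | false = true

finishC9 : Position
finishC9 = central

{-# OPTIONS --safe #-}
-- The argument is a pagoda function: integer weights w on the holes with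
-- w (p + 2v) ≤ w p + w (p + v) for every jump, so that the total weight of the
-- pegs can never increase.  The weights
--
--            -1  0 -1
--             1  1  1
--     -1  1   0  1  0   1 -1
--      0  1   1  1  1   1  0
--     -1  1   0  1  0   1 -1
--             1  1  1
--            -1  0 -1
--
-- form a pagoda function for 8-move jumps (checked by enumerating all jumps),
-- and the start position has weight 4 while the nine central holes have weight 5.
module Submission where

open import Defs
open import Algebra.Bundles using (AbelianGroup)
open import Data.Bool using (Bool; true; false; if_then_else_)
open import Data.Integer using (ℤ; +_; -[1+_]; +≤+; -1ℤ; 1ℤ; _+_; _≤_; _≤?_)
open import Data.Integer.Properties as ℤP
  using (+-0-abelianGroup; +-identityˡ; +-assoc; +-injective; +-monoˡ-≤; ≤-refl; ≤-trans)
open import Data.List using (List; []; _∷_; map; upTo; filter; cartesianProduct)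
open import Data.List.Membership.Propositional using (_∈_)
open import Data.List.Membership.Propositional.Properties using (∈-map⁺; ∈-upTo⁺; ∈-cartesianProduct⁺; ∈-filter⁺; ∈-filter⁻)
open import Data.List.Relation.Unary.All as All using (All; all?)
open import Data.List.Relation.Unary.Any using (here; there)
open import Data.List.Relation.Unary.Unique.Propositional using (Unique; _∷_)
open import Data.List.Relation.Unary.Unique.Propositional.Properties using (map⁺; upTo⁺; cartesianProduct⁺; filter⁺)
open import Data.Nat using (s≤s)
open import Data.Product using (Σ; _×_; _,_; proj₁; proj₂)
open import Data.Product.Properties using (≡-dec)
open import Function using (_∘_)
open import Relation.Binary.Definitions using (DecidableEquality)
open import Relation.Binary.PropositionalEquality using (_≡_; _≢_; refl; sym; trans; cong; ≢-sym; module ≡-Reasoning)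
open import Relation.Nullary using (¬_; Dec; yes; no; contradiction)
open import Relation.Nullary.Decidable using (_×-dec_; _⊎-dec_; _→-dec_; from-yes; from-no)
open import Relation.Unary using (Decidable)
import Data.Integer as ℤ

open import Algebra.Properties.Group (AbelianGroup.group +-0-abelianGroup) using (identityʳ-unique)
open import Algebra.Properties.CommutativeSemigroup (AbelianGroup.commutativeSemigroup +-0-abelianGroup) using (x∙yz≈y∙xz)

module PegWeight {A : Set} (_≟_ : DecidableEquality A) where

  _[_≔_] : (A → Bool) → A → Bool → A → Bool
  (P [ a ≔ b ]) h with h ≟ a
  ... | yes _ = b
  ... | no  _ = P h

  update-same : ∀ P a b → (P [ a ≔ b ]) a ≡ b
  update-same P a b with a ≟ a
  ... | yes _   = refl
  ... | no  a≢a = contradiction refl a≢a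

  update-other : ∀ P {a h} b → h ≢ a → (P [ a ≔ b ]) h ≡ P h
  update-other P {a} {h} b h≢a with h ≟ a
  ... | yes h≡a = contradiction h≡a h≢a
  ... | no  _   = refl

  update-keeps-false : ∀ P a {h} → P h ≡ false → (P [ a ≔ false ]) h ≡ false
  update-keeps-false P a {h} Ph≡false with h ≟ a
  ... | yes _ = refl
  ... | no  _ = Ph≡false

  update-restore : ∀ P {a} → P a ≡ true → ∀ h → ((P [ a ≔ false ]) [ a ≔ true ]) h ≡ P h
  update-restore P {a} Pa≡true h with h ≟ a
  ... | yes refl = sym Pa≡true
  ... | no  h≢a  = update-other P false h≢a

  agree-with-update : ∀ P {Q : A → Bool} {a b} h → Q a ≡ b → (h ≢ a → Q h ≡ P h) →
                      Q h ≡ (P [ a ≔ b ]) h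
  agree-with-update P {a = a} h Qa≡b off with h ≟ a
  ... | yes refl = Qa≡b
  ... | no  h≢a  = off h≢a

  -- Adding the conditional term, rather than branching on the whole sum, keeps
  -- normal forms of weight linear in the length of the list.
  weight : (A → ℤ) → List A → (A → Bool) → ℤ
  weight w []       P = + 0
  weight w (h ∷ hs) P = (if P h then w h else + 0) + weight w hs P

  weight-cong : ∀ w hs {P Q} → (∀ {h} → h ∈ hs → P h ≡ Q h) → weight w hs P ≡ weight w hs Q
  weight-cong w []       P≗Q = refl
  weight-cong w (h ∷ hs) P≗Q rewrite P≗Q (here refl) | weight-cong w hs (P≗Q ∘ there) = refl

  weight-place : ∀ w {hs} P {a} → Unique hs → a ∈ hs → P a ≡ false →
                 weight w hs (P [ a ≔ true ]) ≡ w a + weight w hs P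
  weight-place w {a ∷ hs} P (a∉hs ∷ _) (here refl) Pa≡false
    rewrite update-same P a true | Pa≡false | +-identityˡ (weight w hs P)
    = cong (_+_ (w a)) (weight-cong w hs (update-other P true ∘ ≢-sym ∘ All.lookup a∉hs))
  weight-place w {h ∷ hs} P {a} (h∉hs ∷ hs!) (there a∈hs) Pa≡false
    rewrite update-other P true (All.lookup h∉hs a∈hs) | weight-place w P hs! a∈hs Pa≡false
    = x∙yz≈y∙xz (if P h then w h else + 0) (w a) (weight w hs P)

  weight-remove : ∀ w {hs} P {a} → Unique hs → a ∈ hs → P a ≡ true →
                  weight w hs P ≡ w a + weight w hs (P [ a ≔ false ])
  weight-remove w {hs} P {a} hs! a∈hs Pa≡true = begin
    weight w hs P                                 ≡⟨ weight-cong w hs (λ {h} _ → sym (update-restore P Pa≡true h)) ⟩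
    weight w hs ((P [ a ≔ false ]) [ a ≔ true ])  ≡⟨ weight-place w (P [ a ≔ false ]) hs! a∈hs (update-same P a false) ⟩
    w a + weight w hs (P [ a ≔ false ])           ∎
    where open ≡-Reasoning

_≟ʰ_ : DecidableEquality Hole
_≟ʰ_ = ≡-dec ℤ._≟_ ℤ._≟_

open PegWeight _≟ʰ_

translate≢ : ∀ x {c} → c ≢ + 0 → x + c ≢ x
translate≢ x c≢0 = c≢0 ∘ identityʳ-unique x _

jumpedOver≢start : ∀ p v → step p (+ 1) v ≢ p
jumpedOver≢start (x , y) E  = translate≢ x (λ ()) ∘ cong proj₁
jumpedOver≢start (x , y) W  = translate≢ x (λ ()) ∘ cong proj₁
jumpedOver≢start (x , y) N  = translate≢ y (λ ()) ∘ cong proj₂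
jumpedOver≢start (x , y) S  = translate≢ y (λ ()) ∘ cong proj₂
jumpedOver≢start (x , y) NE = translate≢ x (λ ()) ∘ cong proj₁
jumpedOver≢start (x , y) NW = translate≢ x (λ ()) ∘ cong proj₁
jumpedOver≢start (x , y) SE = translate≢ x (λ ()) ∘ cong proj₁
jumpedOver≢start (x , y) SW = translate≢ x (λ ()) ∘ cong proj₁

PagodaAt : (Hole → ℤ) → Hole → Dir → Set
PagodaAt w p v = OnBoard p → OnBoard (step p (+ 1) v) → OnBoard (step p (+ 2) v) →
                 w (step p (+ 2) v) ≤ w p + w (step p (+ 1) v)

Pagoda : (Hole → ℤ) → Set
Pagoda w = ∀ p v → PagodaAt w p v

module _ (w : Hole → ℤ) {hs : List Hole} (pagoda : Pagoda w) (hs! : Unique hs)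
         (board⊆hs : ∀ {h} → OnBoard h → h ∈ hs) where

  weight-jump : ∀ {P Q} → Jump P Q → weight w hs Q ≤ weight w hs P
  weight-jump {P} {Q} (jump p v onP onP₁ onP₂ Pp Pp₁ Pp₂ Qp Qp₁ Qp₂ frame) = begin
    weight w hs Q                   ≡⟨ weight-cong w hs (λ {h} _ → landing h) ⟩
    weight w hs (P₂ [ p₂ ≔ true ])  ≡⟨ weight-place w P₂ hs! (board⊆hs onP₂) P₂p₂≡false ⟩
    w p₂ + weight w hs P₂           ≤⟨ +-monoˡ-≤ (weight w hs P₂) (pagoda p v onP onP₁ onP₂) ⟩
    w p + w p₁ + weight w hs P₂     ≡⟨ +-assoc (w p) (w p₁) (weight w hs P₂) ⟩
    w p + (w p₁ + weight w hs P₂)   ≡⟨ cong (_+_ (w p)) (weight-remove w P₁ hs! (board⊆hs onP₁) P₁p₁≡true) ⟨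
    w p + weight w hs P₁            ≡⟨ weight-remove w P hs! (board⊆hs onP) Pp ⟨
    weight w hs P                   ∎
    where
    open ℤP.≤-Reasoning
    p₁ p₂ : Hole
    p₁ = step p (+ 1) v
    p₂ = step p (+ 2) v
    P₁ P₂ : Position
    P₁ = P [ p ≔ false ]
    P₂ = P₁ [ p₁ ≔ false ]

    P₁p₁≡true : P₁ p₁ ≡ true
    P₁p₁≡true = trans (update-other P false (jumpedOver≢start p v)) Pp₁

    P₂p₂≡false : P₂ p₂ ≡ false
    P₂p₂≡false = update-keeps-false P₁ p₁ {p₂} (update-keeps-false P p {p₂} Pp₂)

    landing : ∀ h → Q h ≡ (P₂ [ p₂ ≔ true ]) h
    landing h = agree-with-update P₂ h Qp₂ λ h≢p₂ →
                agree-with-update P₁ h Qp₁ λ h≢p₁ →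
                agree-with-update P  h Qp  λ h≢p  → frame h h≢p h≢p₁ h≢p₂

  weight-reachable : ∀ {P Q} → Reachable P Q → weight w hs Q ≤ weight w hs P
  weight-reachable done   = ≤-refl
  weight-reachable (r ▷ j) = ≤-trans (weight-jump j) (weight-reachable r)

In1-7? : Decidable In1-7
In1-7? z = + 1 ≤? z ×-dec z ≤? + 7

In3-5? : Decidable In3-5
In3-5? z = + 3 ≤? z ×-dec z ≤? + 5

OnBoard? : Decidable OnBoard
OnBoard? (x , y) = In1-7? x ×-dec In1-7? y ×-dec (In3-5? x ⊎-dec In3-5? y)

-- upTo 8 also yields the coordinate 0, which the filter in board discards.
coordinates : List ℤ
coordinates = map +_ (upTo 8)

∈-coordinates : ∀ {x} → In1-7 x → x ∈ coordinates
∈-coordinates {+ n}      (_ , +≤+ n≤7) = ∈-map⁺ +_ (∈-upTo⁺ (s≤s n≤7))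
∈-coordinates { -[1+ _ ]} (() , _)

board : List Hole
board = filter OnBoard? (cartesianProduct coordinates coordinates)

board-unique : Unique board
board-unique = filter⁺ OnBoard? (cartesianProduct⁺ coordinates-unique coordinates-unique)
  where
  coordinates-unique : Unique coordinates
  coordinates-unique = map⁺ +-injective (upTo⁺ 8)

∈-board : ∀ {h} → OnBoard h → h ∈ board
∈-board onH@(x∈ , y∈ , _) = ∈-filter⁺ OnBoard? (∈-cartesianProduct⁺ (∈-coordinates x∈) (∈-coordinates y∈)) onH

board-onBoard : ∀ {h} → h ∈ board → OnBoard h
board-onBoard = proj₂ ∘ ∈-filter⁻ OnBoard? {xs = cartesianProduct coordinates coordinates}

directions : List Dir
directions = E ∷ W ∷ N ∷ S ∷ NE ∷ NW ∷ SE ∷ SW ∷ []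

∈-directions : ∀ v → v ∈ directions
∈-directions E  = here refl
∈-directions W  = there (here refl)
∈-directions N  = there (there (here refl))
∈-directions S  = there (there (there (here refl)))
∈-directions NE = there (there (there (there (here refl))))
∈-directions NW = there (there (there (there (there (here refl)))))
∈-directions SE = there (there (there (there (there (there (here refl))))))
∈-directions SW = there (there (there (there (there (there (there (here refl)))))))

PagodaAt? : ∀ w p v → Dec (PagodaAt w p v)
PagodaAt? w p v = OnBoard? p →-dec OnBoard? (step p (+ 1) v) →-dec OnBoard? (step p (+ 2) v) →-dec
                  w (step p (+ 2) v) ≤? w p + w (step p (+ 1) v)

pagoda-byEnumeration : ∀ w → All (λ p → All (PagodaAt w p) directions) board → Pagoda w
pagoda-byEnumeration w table p v onP = All.lookup (All.lookup table (∈-board onP)) (∈-directions v) onP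

pagodaC9 : Hole → ℤ
pagodaC9 (+ 3 , + 1) = -1ℤ
pagodaC9 (+ 5 , + 1) = -1ℤ
pagodaC9 (+ 3 , + 2) = 1ℤ
pagodaC9 (+ 4 , + 2) = 1ℤ
pagodaC9 (+ 5 , + 2) = 1ℤ
pagodaC9 (+ 1 , + 3) = -1ℤ
pagodaC9 (+ 2 , + 3) = 1ℤ
pagodaC9 (+ 4 , + 3) = 1ℤ
pagodaC9 (+ 6 , + 3) = 1ℤ
pagodaC9 (+ 7 , + 3) = -1ℤ
pagodaC9 (+ 2 , + 4) = 1ℤ
pagodaC9 (+ 3 , + 4) = 1ℤ
pagodaC9 (+ 4 , + 4) = 1ℤ
pagodaC9 (+ 5 , + 4) = 1ℤ
pagodaC9 (+ 6 , + 4) = 1ℤ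
pagodaC9 (+ 1 , + 5) = -1ℤ
pagodaC9 (+ 2 , + 5) = 1ℤ
pagodaC9 (+ 4 , + 5) = 1ℤ
pagodaC9 (+ 6 , + 5) = 1ℤ
pagodaC9 (+ 7 , + 5) = -1ℤ
pagodaC9 (+ 3 , + 6) = 1ℤ
pagodaC9 (+ 4 , + 6) = 1ℤ
pagodaC9 (+ 5 , + 6) = 1ℤ
pagodaC9 (+ 3 , + 7) = -1ℤ
pagodaC9 (+ 5 , + 7) = -1ℤ
pagodaC9 _           = + 0

pagodaC9-pagoda : Pagoda pagodaC9
pagodaC9-pagoda = pagoda-byEnumeration pagodaC9
  (from-yes (all? (λ p → all? (PagodaAt? pagodaC9 p) directions) board))

weight-startC9c : weight pagodaC9 board startC9c ≡ + 4
weight-startC9c = refl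

weight-finishC9 : weight pagodaC9 board finishC9 ≡ + 5
weight-finishC9 = refl

mainTheorem5 : ¬ Σ Position (λ Q → Reachable startC9c Q × SameOnBoard Q finishC9)
mainTheorem5 (Q , startC9c↝Q , Q≈finishC9) = from-no (+ 5 ≤? + 4) (begin
  + 5                               ≡⟨ weight-finishC9 ⟨
  weight pagodaC9 board finishC9    ≡⟨ weight-cong pagodaC9 board (Q≈finishC9 _ ∘ board-onBoard) ⟨
  weight pagodaC9 board Q           ≤⟨ weight-reachable pagodaC9 pagodaC9-pagoda board-unique ∈-board startC9c↝Q ⟩
  weight pagodaC9 board startC9c    ≡⟨ weight-startC9c ⟩
  + 4                               ∎)
  where open ℤP.≤-Reasoning
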